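{- Let $p>1$ and $k\geq 1$ be integers. If $G$ is a $k$-degenerate graph with $n\geq k+1$ vertices, then $e_p(G)\leq k(n-1)^p+(n-k)k^p$, with equality if and only if $G\cong S_{n,k}$.
   Context: All graphs are finite, undirected and simple. For a graph $G$, $e_p(G)=\sum_{v\in V(G)} d_G(v)^p$, where $d_G(v)$ is the degree of $v$. A graph is $k$-degenerate if every subgraph has minimum degree at most $k$. $S_{n,k}$ is the graph obtained from the complete graph $K_k$ by joining each of its vertices to each of $n-k$ additional isolated vertices. -}

module Defs where

open import Data.Nat using (ℕ; zero; suc; _+_; _*_; _∸_; _^_; _≤_; _<_; _<ᵇ_)
open import Data.Bool using (Bool; true; false; if_then_else_; _∧_; _∨_; not)
open import Data.Fin using (Fin; zero; suc; toℕ; _≟_)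
open import Data.Product using (Σ; _×_; ∃)
open import Relation.Nullary.Decidable using (⌊_⌋)
open import Relation.Binary.PropositionalEquality using (_≡_)
open import Function.Bundles using (_↔_; Inverse)

sumFin : {n : ℕ} → (Fin n → ℕ) → ℕ
sumFin {zero}  f = 0
sumFin {suc n} f = f zero + sumFin (λ i → f (suc i))

countFin : {n : ℕ} → (Fin n → Bool) → ℕ
countFin b = sumFin (λ i → if b i then 1 else 0)

record Graph (n : ℕ) : Set where
  field
    adj    : Fin n → Fin n → Bool
    sym    : ∀ i j → adj i j ≡ adj j i
    irrefl : ∀ i → adj i i ≡ false
open Graph public

degree : {n : ℕ} → Graph n → Fin n → ℕ
degree G v = countFin (adj G v)

e : {n : ℕ} → ℕ → Graph n → ℕ
e p G = sumFin (λ v → degree G v ^ p)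

IsSubgraph : {n : ℕ} → Graph n → (Fin n → Bool) → (Fin n → Fin n → Bool) → Set
IsSubgraph G S H =
  (∀ i j → H i j ≡ H j i) ×
  (∀ i j → H i j ≡ true → (adj G i j ≡ true) × (S i ≡ true) × (S j ≡ true))

Degenerate : {n : ℕ} → ℕ → Graph n → Set
Degenerate {n} k G =
  ∀ (S : Fin n → Bool) (H : Fin n → Fin n → Bool) →
  IsSubgraph G S H → ∃ (λ v → S v ≡ true) →
  ∃ (λ v → (S v ≡ true) × (countFin (H v) ≤ k))

_≅_ : {n m : ℕ} → Graph n → Graph m → Set
_≅_ {n} {m} G H = Σ (Fin n ↔ Fin m) (λ f →
  ∀ i j → adj G i j ≡ adj H (Inverse.to f i) (Inverse.to f j))

-- S_{n,k}: vertices 0..k-1 form K_k, joined to all of the remaining n-k vertices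
-- (which are pairwise non-adjacent).
S : (n k : ℕ) → Graph n
S n k = record
  { adj    = λ i j → not ⌊ i ≟ j ⌋ ∧ ((toℕ i <ᵇ k) ∨ (toℕ j <ᵇ k))
  ; sym    = symS
  ; irrefl = irr
  }
  where
  open import Relation.Binary.PropositionalEquality using (refl; sym)
  open import Relation.Nullary using (yes; no)
  open import Data.Bool.Properties using (∨-comm)
  symS : ∀ i j → (not ⌊ i ≟ j ⌋ ∧ ((toℕ i <ᵇ k) ∨ (toℕ j <ᵇ k))) ≡ (not ⌊ j ≟ i ⌋ ∧ ((toℕ j <ᵇ k) ∨ (toℕ i <ᵇ k)))
  symS i j with i ≟ j | j ≟ i
  ... | yes refl | yes _ = refl
  ... | yes refl | no q = Data.Empty.⊥-elim (q refl) where import Data.Empty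
  ... | no q | yes refl = Data.Empty.⊥-elim (q refl) where import Data.Empty
  ... | no _ | no _ = ∨-comm ((toℕ i <ᵇ k)) ((toℕ j <ᵇ k))
  irr : ∀ i → (not ⌊ i ≟ i ⌋ ∧ ((toℕ i <ᵇ k) ∨ (toℕ i <ᵇ k))) ≡ false
  irr i with i ≟ i
  ... | yes _ = refl
  ... | no q = Data.Empty.⊥-elim (q refl) where import Data.Empty

-- Let T be the vertex set still present, |T| = k + 1 + t, and remove a vertex v of minimum degree
-- d ≤ k (k-degeneracy).  Each of the d neighbours of v loses one unit of degree, and as all degrees
-- in T ─ v are at most k + t, convexity of x ↦ x ^ p bounds each loss by (k+t+1)^p − (k+t)^p.  Hence
--   e_p(T) ≤ d^p + e_p(T ─ v) + d ((k+t+1)^p − (k+t)^p) ≤ k (k+t+1)^p + (t+2) k^p = e_p(S_{k+2+t,k})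
-- by induction on t.  For p ≥ 2 the convexity is strict, so equality forces d = k, equality for
-- T ─ v, and maximal degree k + t for all neighbours of v.  Inductively G then has k vertices of
-- degree n − 1 and n − k vertices of degree k, and such a degree pattern pins G down as S_{n,k}.
module Submission where

open import Defs hiding (sym)
open import Data.Nat using (ℕ; zero; suc; _+_; _*_; _∸_; _^_; _≤_; _<_; _≤′_; ≤′-refl; ≤′-step; _<ᵇ_)
open import Data.Nat using (z≤n; s≤s; NonZero; >-nonZero)
open import Data.Nat.Properties hiding (_≟_)
open import Data.Nat.Tactic.RingSolver using (solve-∀)
open import Data.Bool using (Bool; true; false; if_then_else_; _∧_; _∨_; not)
open import Data.Bool.Properties using (∧-commutativeMonoid; not-¬; ∧-identityʳ; ∧-zeroʳ; not-injective; if-cong; if-∧)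
open import Data.Fin using (Fin; zero; suc; toℕ; _≟_)
import Data.Fin.Properties as Fin
open import Data.Fin.Permutation using (Permutation; _⟨$⟩ʳ_; _⟨$⟩ˡ_; inverseˡ; lift₀; transpose; _∘ₚ_)
import Data.Fin.Permutation as Perm
open import Data.Product using (Σ; _×_; ∃; _,_; proj₁; proj₂)
open import Data.Empty using (⊥; ⊥-elim)
open import Data.Sum using (inj₁; inj₂)
open import Relation.Nullary using (yes; no)
open import Relation.Binary.Definitions using (tri<; tri≈; tri>)
open import Relation.Nullary.Decidable using (⌊_⌋; ⌊⌋-map′)
open import Relation.Binary.PropositionalEquality
open import Function.Bundles using (_⇔_; mk⇔)
open import Function using (_∘_)
open import Algebra.Properties.CommutativeSemigroup +-commutativeSemigroup using (x∙yz≈y∙xz)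
open import Algebra.Bundles using (CommutativeMonoid)
import Algebra.Properties.CommutativeSemigroup (CommutativeMonoid.commutativeSemigroup ∧-commutativeMonoid) as ∧
open import Algebra.Properties.CommutativeMonoid.Sum +-0-commutativeMonoid using (sum; ∑-distrib-+; sum-permute)

private variable
  m n : ℕ

-- Sums and counts over Fin n

sumFin-cong : {f g : Fin n → ℕ} → (∀ i → f i ≡ g i) → sumFin f ≡ sumFin g
sumFin-cong {zero}  f≗g = refl
sumFin-cong {suc n} f≗g = cong₂ _+_ (f≗g zero) (sumFin-cong (f≗g ∘ suc))

sumFin-mono : {f g : Fin n → ℕ} → (∀ i → f i ≤ g i) → sumFin f ≤ sumFin g
sumFin-mono {zero}  f≤g = z≤n
sumFin-mono {suc n} f≤g = +-mono-≤ (f≤g zero) (sumFin-mono (f≤g ∘ suc))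

+-mono-≤-≡ : ∀ {a b c d} → a ≤ b → c ≤ d → a + c ≡ b + d → a ≡ b × c ≡ d
+-mono-≤-≡ {a} {b} {c} {d} a≤b c≤d eq = a≡b , +-cancelˡ-≡ a c d (trans eq (cong (_+ d) (sym a≡b)))
  where
  a≡b : a ≡ b
  a≡b = ≤-antisym a≤b (+-cancelʳ-≤ c b a (≤-trans (+-monoʳ-≤ b c≤d) (≤-reflexive (sym eq))))

≤-squeeze : ∀ {a b c} → a ≤ b → b ≤ c → a ≡ c → a ≡ b × b ≡ c
≤-squeeze a≤b b≤c refl = ≤-antisym a≤b b≤c , ≤-antisym b≤c a≤b

sumFin-≡⇒≡ : {f g : Fin n → ℕ} → (∀ i → f i ≤ g i) → sumFin f ≡ sumFin g → ∀ i → f i ≡ g i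
sumFin-≡⇒≡ {suc n} f≤g eq zero    = proj₁ (+-mono-≤-≡ (f≤g zero) (sumFin-mono (f≤g ∘ suc)) eq)
sumFin-≡⇒≡ {suc n} f≤g eq (suc i) =
  sumFin-≡⇒≡ (f≤g ∘ suc) (proj₂ (+-mono-≤-≡ (f≤g zero) (sumFin-mono (f≤g ∘ suc)) eq)) i

sumFin≡sum : (f : Fin n → ℕ) → sumFin f ≡ sum f
sumFin≡sum {zero}  f = refl
sumFin≡sum {suc n} f = cong (f zero +_) (sumFin≡sum (f ∘ suc))

sumFin-+ : (f g : Fin n → ℕ) → sumFin (λ i → f i + g i) ≡ sumFin f + sumFin g
sumFin-+ f g = begin
  sumFin (λ i → f i + g i) ≡⟨ sumFin≡sum (λ i → f i + g i) ⟩
  sum (λ i → f i + g i)    ≡⟨ ∑-distrib-+ f g ⟩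
  sum f + sum g            ≡⟨ sym (cong₂ _+_ (sumFin≡sum f) (sumFin≡sum g)) ⟩
  sumFin f + sumFin g      ∎
  where open ≡-Reasoning

sumFin-permute : (f : Fin n → ℕ) (π : Permutation m n) → sumFin (f ∘ (π ⟨$⟩ʳ_)) ≡ sumFin f
sumFin-permute f π = begin
  sumFin (f ∘ (π ⟨$⟩ʳ_)) ≡⟨ sumFin≡sum (f ∘ (π ⟨$⟩ʳ_)) ⟩
  sum (f ∘ (π ⟨$⟩ʳ_))    ≡⟨ sym (sum-permute f π) ⟩
  sum f                  ≡⟨ sym (sumFin≡sum f) ⟩
  sumFin f               ∎
  where open ≡-Reasoning

sumFin-remove : (f : Fin n → ℕ) (v : Fin n) → sumFin f ≡ f v + sumFin (λ u → if ⌊ v ≟ u ⌋ then 0 else f u)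
sumFin-remove f zero    = refl
sumFin-remove f (suc v) = begin
  f zero + sumFin (f ∘ suc)       ≡⟨ cong (f zero +_) (sumFin-remove (f ∘ suc) v) ⟩
  f zero + (f (suc v) + rest)     ≡⟨ x∙yz≈y∙xz (f zero) (f (suc v)) rest ⟩
  f (suc v) + (f zero + rest)     ≡⟨ cong (λ r → f (suc v) + (f zero + r)) (sumFin-cong ≟-suc) ⟩
  f (suc v) + (f zero + rest′)    ∎
  where
  open ≡-Reasoning
  rest rest′ : ℕ
  rest  = sumFin (λ u → if ⌊ v ≟ u ⌋ then 0 else f (suc u))
  rest′ = sumFin (λ u → if ⌊ suc v ≟ suc u ⌋ then 0 else f (suc u))
  ≟-suc : ∀ u → (if ⌊ v ≟ u ⌋ then 0 else f (suc u)) ≡ (if ⌊ suc v ≟ suc u ⌋ then 0 else f (suc u))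
  ≟-suc u = cong (if_then 0 else f (suc u)) (sym (⌊⌋-map′ (cong suc) Fin.suc-injective (v ≟ u)))

∧≡true⇒ : ∀ {x y} → x ∧ y ≡ true → x ≡ true × y ≡ true
∧≡true⇒ {true} y≡true = refl , y≡true

_⊆_ : (P Q : Fin n → Bool) → Set
P ⊆ Q = ∀ i → P i ≡ true → Q i ≡ true

_─_ : (Fin n → Bool) → Fin n → Fin n → Bool
(P ─ v) u = P u ∧ not ⌊ v ≟ u ⌋

─-∈ : (T : Fin n → Bool) {u v : Fin n} → T u ≡ true → v ≢ u → (T ─ v) u ≡ true
─-∈ T {u} {v} Tu v≢u with v ≟ u
... | yes v≡u = ⊥-elim (v≢u v≡u)
... | no _ rewrite Tu = refl

sumOver : (Fin n → Bool) → (Fin n → ℕ) → ℕ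
sumOver P f = sumFin (λ u → if P u then f u else 0)

sumOver-remove : (P : Fin n → Bool) (f : Fin n → ℕ) (v : Fin n) →
  sumOver P f ≡ (if P v then f v else 0) + sumOver (P ─ v) f
sumOver-remove P f v = trans (sumFin-remove _ v) (cong (_ +_) (sumFin-cong removed))
  where
  removed : ∀ u → (if ⌊ v ≟ u ⌋ then 0 else (if P u then f u else 0)) ≡ (if (P ─ v) u then f u else 0)
  removed u with ⌊ v ≟ u ⌋ | P u
  ... | true  | true  = refl
  ... | true  | false = refl
  ... | false | true  = refl
  ... | false | false = refl

sumOver-+ : (P : Fin n → Bool) (f g : Fin n → ℕ) → sumOver P (λ u → f u + g u) ≡ sumOver P f + sumOver P g
sumOver-+ P f g = trans (sumFin-cong if-+) (sumFin-+ (λ u → if P u then f u else 0) (λ u → if P u then g u else 0))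
  where
  if-+ : ∀ u → (if P u then f u + g u else 0) ≡ (if P u then f u else 0) + (if P u then g u else 0)
  if-+ u with P u
  ... | true  = refl
  ... | false = refl

sumOver-const : (P : Fin n → Bool) (x : ℕ) → sumOver P (λ _ → x) ≡ countFin P * x
sumOver-const {zero}  P x = refl
sumOver-const {suc n} P x with P zero
... | true  = cong (x +_) (sumOver-const (P ∘ suc) x)
... | false = sumOver-const (P ∘ suc) x

sumOver-if-const : (P Q : Fin n → Bool) (x : ℕ) →
  sumOver P (λ u → if Q u then x else 0) ≡ countFin (λ u → P u ∧ Q u) * x
sumOver-if-const P Q x = trans (sumFin-cong (λ u → sym (if-∧ (P u)))) (sumOver-const (λ u → P u ∧ Q u) x)

sumFin-if : (P : Fin n → Bool) (x y : ℕ) →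
  sumFin (λ u → if P u then x else y) ≡ countFin P * x + countFin (not ∘ P) * y
sumFin-if {zero}  P x y = refl
sumFin-if {suc n} P x y with P zero
... | true  = trans (cong (x +_) (sumFin-if (P ∘ suc) x y)) (sym (+-assoc x _ _))
... | false = trans (cong (y +_) (sumFin-if (P ∘ suc) x y)) (x∙yz≈y∙xz y (countFin (P ∘ suc) * x) _)

⊆⇒indicator-≤ : {P Q : Fin n → Bool} → P ⊆ Q → ∀ i → (if P i then 1 else 0) ≤ (if Q i then 1 else 0)
⊆⇒indicator-≤ {P = P} P⊆Q i with P i in Pi
... | false = z≤n
... | true rewrite P⊆Q i Pi = ≤-refl

countFin-mono : {P Q : Fin n → Bool} → P ⊆ Q → countFin P ≤ countFin Q
countFin-mono P⊆Q = sumFin-mono (⊆⇒indicator-≤ P⊆Q)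

countFin-cong : {P Q : Fin n → Bool} → (∀ i → P i ≡ Q i) → countFin P ≡ countFin Q
countFin-cong P≗Q = sumFin-cong (λ i → cong (if_then 1 else 0) (P≗Q i))

countFin-⊆-≡⇒≗ : {P Q : Fin n → Bool} → P ⊆ Q → countFin P ≡ countFin Q → ∀ i → P i ≡ Q i
countFin-⊆-≡⇒≗ {P = P} {Q} P⊆Q eq i with P i in Pi | Q i in Qi | sumFin-≡⇒≡ (⊆⇒indicator-≤ P⊆Q) eq i
... | true  | true  | _ = refl
... | false | false | _ = refl
... | true  | false | _ with () ← trans (sym (P⊆Q i Pi)) Qi
... | false | true  | ()

countFin-true : countFin {n} (λ _ → true) ≡ n
countFin-true {zero}  = refl
countFin-true {suc n} = cong suc countFin-true

countFin-complement : (P : Fin n → Bool) → countFin P + countFin (not ∘ P) ≡ n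
countFin-complement {zero}  P = refl
countFin-complement {suc n} P with P zero
... | true  = cong suc (countFin-complement (P ∘ suc))
... | false = trans (+-suc _ _) (cong suc (countFin-complement (P ∘ suc)))

countFin-remove : (P : Fin n → Bool) (v : Fin n) → P v ≡ true → countFin P ≡ suc (countFin (P ─ v))
countFin-remove P v Pv = trans (sumOver-remove P (λ _ → 1) v) (cong (λ b → (if b then 1 else 0) + countFin (P ─ v)) Pv)

countFin-nonempty : (P : Fin n → Bool) → countFin P ≡ suc m → ∃ λ v → P v ≡ true
countFin-nonempty {suc n} P eq with P zero in P0
... | true  = zero , P0
... | false with v , Pv ← countFin-nonempty (P ∘ suc) eq = suc v , Pv

countFin-<ᵇ : ∀ k → k ≤ n → countFin {n} (λ j → toℕ j <ᵇ k) ≡ k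
countFin-<ᵇ {zero}  zero    _         = refl
countFin-<ᵇ {suc n} zero    _         = countFin-<ᵇ {n} zero z≤n
countFin-<ᵇ {suc n} (suc k) (s≤s k≤n) = cong suc (countFin-<ᵇ k k≤n)

countFin-≡⇒witness : (P Q : Fin n → Bool) → countFin P ≡ countFin Q → ∀ i → ∃ λ j → Q j ≡ P i
countFin-≡⇒witness P Q eq i with P i in Pi
... | true  = countFin-nonempty Q (trans (sym eq) (countFin-remove P i Pi))
... | false = let j , ¬Qj = countFin-nonempty (not ∘ Q) complements-≡ in j , not-injective ¬Qj
  where
  complements-≡ : countFin (not ∘ Q) ≡ suc (countFin ((not ∘ P) ─ i))
  complements-≡ = trans
    (+-cancelˡ-≡ (countFin Q) _ _ (trans (countFin-complement Q) (trans (sym (countFin-complement P)) (cong (_+ _) eq))))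
    (countFin-remove (not ∘ P) i (cong not Pi))

countFin-≡⇒permutation : (P Q : Fin n → Bool) → countFin P ≡ countFin Q →
  Σ (Permutation n n) λ σ → ∀ i → Q (σ ⟨$⟩ʳ i) ≡ P i
countFin-≡⇒permutation {zero}  P Q eq = Perm.id , λ ()
countFin-≡⇒permutation {suc n} P Q eq with j , Qj≡P0 ← countFin-≡⇒witness P Q eq zero =
  lift₀ ρ ∘ₚ τ , σ-matches
  where
  τ : Permutation (suc n) (suc n)
  τ = transpose zero j
  Qτ : Fin (suc n) → Bool
  Qτ = Q ∘ (τ ⟨$⟩ʳ_)
  tails-≡ : countFin (P ∘ suc) ≡ countFin (Qτ ∘ suc)
  tails-≡ = +-cancelˡ-≡ (if P zero then 1 else 0) _ _ (begin
    countFin P                                       ≡⟨ eq ⟩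
    countFin Q                                       ≡⟨ sumFin-permute (λ u → if Q u then 1 else 0) τ ⟨
    (if Q j then 1 else 0) + countFin (Qτ ∘ suc)
      ≡⟨ cong (λ b → (if b then 1 else 0) + countFin (Qτ ∘ suc)) Qj≡P0 ⟩
    (if P zero then 1 else 0) + countFin (Qτ ∘ suc)  ∎)
    where open ≡-Reasoning
  ρ : Permutation n n
  ρ = proj₁ (countFin-≡⇒permutation (P ∘ suc) (Qτ ∘ suc) tails-≡)
  σ-matches : ∀ i → Q ((lift₀ ρ ∘ₚ τ) ⟨$⟩ʳ i) ≡ P i
  σ-matches zero    = Qj≡P0
  σ-matches (suc i) = proj₂ (countFin-≡⇒permutation (P ∘ suc) (Qτ ∘ suc) tails-≡) i

-- Convexity of x ↦ x ^ p

+-telescope-≤ : ∀ δ a b c d e → a + b ≤ c + d → δ + (d + d) ≤ b + e → δ + (a + d) ≤ c + e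
+-telescope-≤ δ a b c d e h₁ h₂ =
  +-cancelʳ-≤ (b + d) (δ + (a + d)) (c + e)
    (subst₂ _≤_ (lhs-≡ δ a b d) (rhs-≡ b c d e) (+-mono-≤ h₁ h₂))
  where
  lhs-≡ : ∀ δ a b d → a + b + (δ + (d + d)) ≡ δ + (a + d) + (b + d)
  lhs-≡ = solve-∀
  rhs-≡ : ∀ b c d e → c + d + (b + e) ≡ c + e + (b + d)
  rhs-≡ = solve-∀

-- δ = 0 yields convexity of x ↦ x ^ p, and δ = 1 strict convexity from p = 2 on.
^-secondDifference-step : ∀ δ r x → δ + (suc x ^ r + suc x ^ r) ≤ x ^ r + suc (suc x) ^ r →
  δ + (suc x ^ suc r + suc x ^ suc r) ≤ x ^ suc r + suc (suc x) ^ suc r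
^-secondDifference-step δ r x hyp = begin
  δ + (suc x * Z + suc x * Z)   ≤⟨ m≤m+n _ (x * δ) ⟩
  δ + (suc x * Z + suc x * Z) + x * δ ≡⟨ factor δ x Z ⟩
  suc x * (δ + (Z + Z))         ≤⟨ *-monoʳ-≤ (suc x) hyp ⟩
  suc x * (W + V)               ≤⟨ +-cancelʳ-≤ W _ _ (subst (suc x * (W + V) + W ≤_) (expand x W V) (+-monoʳ-≤ _ W≤V)) ⟩
  x * W + suc (suc x) * V       ∎
  where
  open ≤-Reasoning
  Z W V : ℕ
  Z = suc x ^ r
  W = x ^ r
  V = suc (suc x) ^ r
  W≤V : W ≤ V
  W≤V = ^-monoˡ-≤ r (m≤n+m x 2)
  factor : ∀ δ x Z → δ + (suc x * Z + suc x * Z) + x * δ ≡ suc x * (δ + (Z + Z))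
  factor = solve-∀
  expand : ∀ x W V → suc x * (W + V) + V ≡ x * W + suc (suc x) * V + W
  expand = solve-∀

^-convex : ∀ p x → suc x ^ p + suc x ^ p ≤ x ^ p + suc (suc x) ^ p
^-convex zero    x = ≤-refl
^-convex (suc r) x = ^-secondDifference-step 0 r x (^-convex r x)

^-strictlyConvex : ∀ p x → 2 ≤ p → suc x ^ p + suc x ^ p < x ^ p + suc (suc x) ^ p
^-strictlyConvex 2 x _ = subst (suc (suc x ^ 2 + suc x ^ 2) ≤_) (square-identity x) (m≤m+n _ 1)
  where
  square-identity : ∀ x → suc (suc x * (suc x * 1) + suc x * (suc x * 1)) + 1 ≡ x * (x * 1) + suc (suc x) * (suc (suc x) * 1)
  square-identity = solve-∀
^-strictlyConvex 1 x (s≤s ())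
^-strictlyConvex (suc (suc (suc r))) x _ =
  ^-secondDifference-step 1 (suc (suc r)) x (^-strictlyConvex (suc (suc r)) x (s≤s (s≤s z≤n)))

^-increment-mono : ∀ p {a b} → a ≤ b → suc a ^ p + b ^ p ≤ a ^ p + suc b ^ p
^-increment-mono p {a} a≤b = go (≤⇒≤′ a≤b)
  where
  go : ∀ {b} → a ≤′ b → suc a ^ p + b ^ p ≤ a ^ p + suc b ^ p
  go ≤′-refl        = ≤-reflexive (+-comm (suc a ^ p) (a ^ p))
  go {suc b} (≤′-step a≤′b) =
    +-telescope-≤ 0 (suc a ^ p) (b ^ p) (a ^ p) (suc b ^ p) (suc (suc b) ^ p) (go a≤′b) (^-convex p b)

^-increment-strictMono : ∀ p {a b} → 2 ≤ p → a < b → suc a ^ p + b ^ p < a ^ p + suc b ^ p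
^-increment-strictMono p {a} {suc b} 2≤p (s≤s a≤b) =
  +-telescope-≤ 1 (suc a ^ p) (b ^ p) (a ^ p) (suc b ^ p) (suc (suc b) ^ p)
    (^-increment-mono p a≤b) (^-strictlyConvex p b 2≤p)

-- Degrees in induced subgraphs

module _ {n} (G : Graph n) where

  degIn : (Fin n → Bool) → Fin n → ℕ
  degIn T v = countFin (λ u → T u ∧ adj G v u)

  energy : ℕ → (Fin n → Bool) → ℕ
  energy p T = sumOver T (λ v → degIn T v ^ p)

  adj⇒≢ : ∀ {u v} → adj G v u ≡ true → v ≢ u
  adj⇒≢ {u} {v} vu refl with () ← trans (sym vu) (irrefl G v)

  degIn-< : ∀ {T u} → T u ≡ true → degIn T u < countFin T
  degIn-< {T} {u} Tu = ≤-trans (s≤s (countFin-mono neighbours⊆)) (≤-reflexive (sym (countFin-remove T u Tu)))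
    where
    neighbours⊆ : (λ w → T w ∧ adj G u w) ⊆ (T ─ u)
    neighbours⊆ w Tw∧uw = let Tw , uw = ∧≡true⇒ Tw∧uw in ─-∈ T Tw (adj⇒≢ uw)

  degIn-remove : ∀ {T v} → T v ≡ true → ∀ u → degIn T u ≡ (if adj G v u then 1 else 0) + degIn (T ─ v) u
  degIn-remove {T} {v} Tv u = begin
    degIn T u
      ≡⟨ sumOver-remove (λ w → T w ∧ adj G u w) (λ _ → 1) v ⟩
    (if T v ∧ adj G u v then 1 else 0) + countFin ((λ w → T w ∧ adj G u w) ─ v)
      ≡⟨ cong₂ _+_ first-term (countFin-cong reorder) ⟩
    (if adj G v u then 1 else 0) + degIn (T ─ v) u
      ∎
    where
    open ≡-Reasoning
    first-term : (if T v ∧ adj G u v then 1 else 0) ≡ (if adj G v u then 1 else 0)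
    first-term rewrite Tv | Graph.sym G u v = refl
    reorder : ∀ w → (T w ∧ adj G u w) ∧ not ⌊ v ≟ w ⌋ ≡ (T w ∧ not ⌊ v ≟ w ⌋) ∧ adj G u w
    reorder w = ∧.xy∙z≈xz∙y (T w) (adj G u w) (not ⌊ v ≟ w ⌋)

  degIn-remove-adj : ∀ {T v u} → T v ≡ true → adj G v u ≡ true → degIn T u ≡ suc (degIn (T ─ v) u)
  degIn-remove-adj {T} {v} {u} Tv vu = trans (degIn-remove Tv u) (cong (λ b → (if b then 1 else 0) + degIn (T ─ v) u) vu)

  degIn-remove-nonadj : ∀ {T v u} → T v ≡ true → adj G v u ≡ false → degIn T u ≡ degIn (T ─ v) u
  degIn-remove-nonadj {T} {v} {u} Tv vu = trans (degIn-remove Tv u) (cong (λ b → (if b then 1 else 0) + degIn (T ─ v) u) vu)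

  degIn-removed-self : ∀ T v → degIn (T ─ v) v ≡ degIn T v
  degIn-removed-self T v = countFin-cong no-loop
    where
    no-loop : ∀ u → (T u ∧ not ⌊ v ≟ u ⌋) ∧ adj G v u ≡ T u ∧ adj G v u
    no-loop u with v ≟ u
    ... | no _     = cong (_∧ adj G v u) (∧-identityʳ (T u))
    ... | yes refl rewrite irrefl G v = trans (∧-zeroʳ _) (sym (∧-zeroʳ (T v)))

  energy-remove : ∀ p {T v} → T v ≡ true → energy p T ≡ degIn T v ^ p + sumOver (T ─ v) (λ u → degIn T u ^ p)
  energy-remove p {T} {v} Tv =
    trans (sumOver-remove T (λ u → degIn T u ^ p) v)
          (cong (λ b → (if b then degIn T v ^ p else 0) + sumOver (T ─ v) (λ u → degIn T u ^ p)) Tv)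

  degenerate⇒lowDegree : ∀ {k T i} → Degenerate k G → T i ≡ true → ∃ λ v → T v ≡ true × degIn T v ≤ k
  degenerate⇒lowDegree {k} {T} {i} degenerate Ti = low (degenerate T induced (induced-sym , induced-edge) (i , Ti))
    where
    induced : Fin n → Fin n → Bool
    induced u w = T u ∧ (T w ∧ adj G u w)
    induced-sym : ∀ u w → induced u w ≡ induced w u
    induced-sym u w rewrite Graph.sym G u w with T u | T w
    ... | true  | true  = refl
    ... | true  | false = refl
    ... | false | true  = refl
    ... | false | false = refl
    induced-edge : ∀ u w → induced u w ≡ true → (adj G u w ≡ true) × (T u ≡ true) × (T w ≡ true)
    induced-edge u w uw with T u | T w
    ... | true | true = uw , refl , refl
    low : (∃ λ v → T v ≡ true × countFin (induced v) ≤ k) → ∃ λ v → T v ≡ true × degIn T v ≤ k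
    low (v , Tv , deg≤k) = v , Tv , subst (λ b → countFin (λ w → b ∧ (T w ∧ adj G v w)) ≤ k) Tv deg≤k

^-cancelʳ-≡ : ∀ p .{{_ : NonZero p}} {a b} → a ^ p ≡ b ^ p → a ≡ b
^-cancelʳ-≡ p {a} {b} eq with <-cmp a b
... | tri< a<b _ _ = ⊥-elim (<-irrefl eq (^-monoˡ-< p a<b))
... | tri≈ _ a≡b _ = a≡b
... | tri> _ _ b<a = ⊥-elim (<-irrefl (sym eq) (^-monoˡ-< p b<a))

-- Removing a vertex of small degree

module Peel {n} (G : Graph n) (p : ℕ) {T : Fin n → Bool} {v : Fin n} (Tv : T v ≡ true)
            (m : ℕ) (count : countFin (T ─ v) ≡ suc m) where

  oldDegreesSum : ℕ
  oldDegreesSum = sumOver (T ─ v) (λ u → degIn G T u ^ p)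

  private
    before after : Fin n → ℕ
    before u = if (T ─ v) u then degIn G T u ^ p + (if adj G v u then m ^ p else 0) else 0
    after  u = if (T ─ v) u then degIn G (T ─ v) u ^ p + (if adj G v u then suc m ^ p else 0) else 0

    degIn-removed-≤ : ∀ u → (T ─ v) u ≡ true → degIn G (T ─ v) u ≤ m
    degIn-removed-≤ u T′u = ≤-pred (subst (degIn G (T ─ v) u <_) count (degIn-< G T′u))

    before≤after : ∀ u → before u ≤ after u
    before≤after u with (T ─ v) u in T′u
    ... | false = z≤n
    ... | true with adj G v u in vu
    ...   | true  = subst (λ x → x ^ p + m ^ p ≤ degIn G (T ─ v) u ^ p + suc m ^ p) (sym (degIn-remove-adj G Tv vu))
                        (^-increment-mono p (degIn-removed-≤ u T′u))
    ...   | false = ≤-reflexive (cong (λ x → x ^ p + 0) (degIn-remove-nonadj G Tv vu))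

    sum-before : sumFin before ≡ oldDegreesSum + degIn G T v * m ^ p
    sum-before = trans (sumOver-+ (T ─ v) _ _) (cong (oldDegreesSum +_)
      (trans (sumOver-if-const (T ─ v) (adj G v) (m ^ p)) (cong (_* m ^ p) (degIn-removed-self G T v))))

    sum-after : sumFin after ≡ energy G p (T ─ v) + degIn G T v * suc m ^ p
    sum-after = trans (sumOver-+ (T ─ v) _ _) (cong (energy G p (T ─ v) +_)
      (trans (sumOver-if-const (T ─ v) (adj G v) (suc m ^ p)) (cong (_* suc m ^ p) (degIn-removed-self G T v))))

  peel-≤ : oldDegreesSum + degIn G T v * m ^ p ≤ energy G p (T ─ v) + degIn G T v * suc m ^ p
  peel-≤ = subst₂ _≤_ sum-before sum-after (sumFin-mono before≤after)

  peel-≡ : 2 ≤ p → oldDegreesSum + degIn G T v * m ^ p ≡ energy G p (T ─ v) + degIn G T v * suc m ^ p →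
    ∀ u → (T ─ v) u ≡ true → adj G v u ≡ true → degIn G (T ─ v) u ≡ m
  peel-≡ 2≤p eq u T′u vu = tight (sumFin-≡⇒≡ before≤after (trans sum-before (trans eq (sym sum-after))) u)
    where
    tight : before u ≡ after u → degIn G (T ─ v) u ≡ m
    tight eqᵤ with m≤n⇒m<n∨m≡n (degIn-removed-≤ u T′u)
    ... | inj₂ deg≡m = deg≡m
    ... | inj₁ deg<m = ⊥-elim (<-irrefl eqᵤ′ (^-increment-strictMono p 2≤p deg<m))
      where
      eqᵤ′ : suc (degIn G (T ─ v) u) ^ p + m ^ p ≡ degIn G (T ─ v) u ^ p + suc m ^ p
      eqᵤ′ = begin
        suc (degIn G (T ─ v) u) ^ p + m ^ p
          ≡⟨ cong₂ (λ x b → x ^ p + (if b then m ^ p else 0)) (degIn-remove-adj G Tv vu) vu ⟨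
        degIn G T u ^ p + (if adj G v u then m ^ p else 0)              ≡⟨ if-cong T′u ⟨
        before u                                                       ≡⟨ eqᵤ ⟩
        after u                                                        ≡⟨ if-cong T′u ⟩
        degIn G (T ─ v) u ^ p + (if adj G v u then suc m ^ p else 0)
          ≡⟨ cong (λ b → degIn G (T ─ v) u ^ p + (if b then suc m ^ p else 0)) vu ⟩
        degIn G (T ─ v) u ^ p + suc m ^ p                              ∎
        where open ≡-Reasoning

extremalEnergy : (p k t : ℕ) → ℕ
extremalEnergy p k t = k * (k + t) ^ p + suc t * k ^ p

module Step {n} (G : Graph n) (p k t : ℕ) {T : Fin n → Bool} {v : Fin n} (Tv : T v ≡ true)
            (v-low : degIn G T v ≤ k) (count : countFin (T ─ v) ≡ suc (k + t))
            (bound : energy G p (T ─ v) ≤ extremalEnergy p k t) where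
  open Peel G p {T} {v} Tv (k + t) count

  private
    d r X Y : ℕ
    d = degIn G T v
    r = proj₁ (m≤n⇒∃[o]m+o≡n v-low)
    X = (k + t) ^ p
    Y = suc (k + t) ^ p

    d+r≡k : d + r ≡ k
    d+r≡k = proj₂ (m≤n⇒∃[o]m+o≡n v-low)

    -- Both ends of the estimate are shifted by k (k+t)^p so that no subtraction occurs.
    lower upper : ℕ
    lower = d ^ p + (oldDegreesSum + d * X) + r * X
    upper = k ^ p + (extremalEnergy p k t + d * Y) + r * Y

    oldDegrees≤ : oldDegreesSum + d * X ≤ extremalEnergy p k t + d * Y
    oldDegrees≤ = ≤-trans peel-≤ (+-monoˡ-≤ (d * Y) bound)

    d^p≤k^p : d ^ p ≤ k ^ p
    d^p≤k^p = ^-monoˡ-≤ p v-low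

    rX≤rY : r * X ≤ r * Y
    rX≤rY = *-monoʳ-≤ r (^-monoˡ-≤ p (n≤1+n (k + t)))

    lower≤upper : lower ≤ upper
    lower≤upper = +-mono-≤ (+-mono-≤ d^p≤k^p oldDegrees≤) rX≤rY

    energy+kX≡lower : energy G p T + k * X ≡ lower
    energy+kX≡lower = begin
      energy G p T + k * X                 ≡⟨ cong₂ (λ e c → e + c * X) (energy-remove G p Tv) (sym d+r≡k) ⟩
      d ^ p + oldDegreesSum + (d + r) * X  ≡⟨ regroup (d ^ p) oldDegreesSum d r X ⟩
      lower                                ∎
      where
      open ≡-Reasoning
      regroup : ∀ a s d r X → a + s + (d + r) * X ≡ a + (s + d * X) + r * X
      regroup = solve-∀

    extremal+kX≡upper : extremalEnergy p k (suc t) + k * X ≡ upper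
    extremal+kX≡upper = begin
      k * (k + suc t) ^ p + suc (suc t) * k ^ p + k * X   ≡⟨ cong (λ z → k * z ^ p + suc (suc t) * k ^ p + k * X) (+-suc k t) ⟩
      k * Y + suc (suc t) * k ^ p + k * X                 ≡⟨ cong (λ c → c * Y + suc (suc t) * k ^ p + k * X) (sym d+r≡k) ⟩
      (d + r) * Y + suc (suc t) * k ^ p + k * X           ≡⟨ regroup d r t k X Y (k ^ p) ⟩
      upper                                               ∎
      where
      open ≡-Reasoning
      regroup : ∀ d r t k X Y K → (d + r) * Y + suc (suc t) * K + k * X ≡ K + (k * X + suc t * K + d * Y) + r * Y
      regroup = solve-∀

  step-≤ : energy G p T ≤ extremalEnergy p k (suc t)
  step-≤ = +-cancelʳ-≤ (k * X) _ _ (subst₂ _≤_ (sym energy+kX≡lower) (sym extremal+kX≡upper) lower≤upper)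

  step-≡ : 2 ≤ p → energy G p T ≡ extremalEnergy p k (suc t) →
    degIn G T v ≡ k × energy G p (T ─ v) ≡ extremalEnergy p k t ×
    (∀ u → (T ─ v) u ≡ true → adj G v u ≡ true → degIn G (T ─ v) u ≡ k + t)
  step-≡ 2≤p eq = d≡k , +-cancelʳ-≡ (d * Y) _ _ (proj₂ squeezed) , peel-≡ 2≤p (proj₁ squeezed)
    where
    tight : lower ≡ upper
    tight = trans (sym energy+kX≡lower) (trans (cong (_+ k * X) eq) extremal+kX≡upper)
    split : d ^ p ≡ k ^ p × oldDegreesSum + d * X ≡ extremalEnergy p k t + d * Y
    split = +-mono-≤-≡ d^p≤k^p oldDegrees≤ (proj₁ (+-mono-≤-≡ (+-mono-≤ d^p≤k^p oldDegrees≤) rX≤rY tight))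
    squeezed : oldDegreesSum + d * X ≡ energy G p (T ─ v) + d * Y × energy G p (T ─ v) + d * Y ≡ extremalEnergy p k t + d * Y
    squeezed = ≤-squeeze peel-≤ (+-monoˡ-≤ (d * Y) bound) (proj₂ split)
    d≡k : d ≡ k
    d≡k = ^-cancelʳ-≡ p {{>-nonZero (≤-trans (s≤s z≤n) 2≤p)}} (proj₁ split)

-- The degree pattern of S_{k+1+t,k} on T; the hubs need not lie in T.
record Extremal {n} (G : Graph n) (k : ℕ) (T : Fin n → Bool) (t : ℕ) : Set where
  field
    hubs       : Fin n → Bool
    count-hubs : countFin hubs ≡ k
    deg-hub    : ∀ i → T i ≡ true → hubs i ≡ true → degIn G T i ≡ k + t
    deg-leaf   : ∀ i → T i ≡ true → hubs i ≡ false → degIn G T i ≡ k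

module _ {n} (G : Graph n) (p k : ℕ) {T : Fin n → Bool} (count : countFin T ≡ suc k) where

  private
    degree-bound : ∀ u → (if T u then degIn G T u ^ p else 0) ≤ (if T u then k ^ p else 0)
    degree-bound u with T u in Tu
    ... | false = z≤n
    ... | true  = ^-monoˡ-≤ p (≤-pred (subst (degIn G T u <_) count (degIn-< G Tu)))

    all-k : sumOver T (λ _ → k ^ p) ≡ extremalEnergy p k 0
    all-k = begin
      sumOver T (λ _ → k ^ p)          ≡⟨ sumOver-const T (k ^ p) ⟩
      countFin T * k ^ p               ≡⟨ cong (_* k ^ p) count ⟩
      suc k * k ^ p                    ≡⟨ split k (k ^ p) ⟩
      k * k ^ p + 1 * k ^ p            ≡⟨ cong (λ z → k * z ^ p + 1 * k ^ p) (+-identityʳ k) ⟨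
      extremalEnergy p k 0             ∎
      where
      open ≡-Reasoning
      split : ∀ k K → suc k * K ≡ k * K + 1 * K
      split = solve-∀

  energy-≤-base : energy G p T ≤ extremalEnergy p k 0
  energy-≤-base = ≤-trans (sumFin-mono degree-bound) (≤-reflexive all-k)

  Extremal-base : .{{_ : NonZero p}} → energy G p T ≡ extremalEnergy p k 0 → Extremal G k T 0
  Extremal-base eq with w , Tw ← countFin-nonempty T count = record
    { hubs       = T ─ w
    ; count-hubs = suc-injective (trans (sym (countFin-remove T w Tw)) count)
    ; deg-hub    = λ u Tu _ → trans (degree≡k u Tu) (sym (+-identityʳ k))
    ; deg-leaf   = λ u Tu _ → degree≡k u Tu
    }
    where
    degree≡k : ∀ u → T u ≡ true → degIn G T u ≡ k
    degree≡k u Tu = ^-cancelʳ-≡ p (begin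
      degIn G T u ^ p                             ≡⟨ if-cong Tu ⟨
      (if T u then degIn G T u ^ p else 0)        ≡⟨ sumFin-≡⇒≡ degree-bound (trans eq (sym all-k)) u ⟩
      (if T u then k ^ p else 0)                  ≡⟨ if-cong Tu ⟩
      k ^ p                                       ∎)
      where open ≡-Reasoning

Extremal-hubs⊆ : ∀ {n} {G : Graph n} {k T t} (E : Extremal G k T (suc t)) (N : Fin n → Bool) → countFin N ≡ k →
  (∀ u → N u ≡ true → T u ≡ true × degIn G T u ≡ k + suc t) → Extremal.hubs E ⊆ N
Extremal-hubs⊆ {k = k} E N count-N N-deg u hub = trans (countFin-⊆-≡⇒≗ N⊆hubs (trans count-N (sym count-hubs)) u) hub
  where
  open Extremal E
  N⊆hubs : N ⊆ hubs
  N⊆hubs u Nu with hubs u in hub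
  ... | true  = refl
  ... | false = ⊥-elim (m+1+n≢m k (trans (sym (proj₂ (N-deg u Nu))) (deg-leaf u (proj₁ (N-deg u Nu)) hub)))

-- For t > 0 the hubs are the only vertices of degree k + t, so the k neighbours of v are exactly the hubs.
Extremal-nonneighbour : ∀ {n} (G : Graph n) {k t T v} → degIn G (T ─ v) v ≡ k → Extremal G k (T ─ v) t →
  (∀ u → (T ─ v) u ≡ true → adj G v u ≡ true → degIn G (T ─ v) u ≡ k + t) →
  ∀ u → (T ─ v) u ≡ true → adj G v u ≡ false → degIn G (T ─ v) u ≡ k
Extremal-nonneighbour G {k} {zero} old-deg-v old nbr-deg u T′u vu with Extremal.hubs old u in hub
... | false = Extremal.deg-leaf old u T′u hub
... | true  = trans (Extremal.deg-hub old u T′u hub) (+-identityʳ k)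
Extremal-nonneighbour G {k} {suc t} {T} {v} old-deg-v old nbr-deg u T′u vu with Extremal.hubs old u in hub
... | false = Extremal.deg-leaf old u T′u hub
... | true = ⊥-elim (not-neighbour (hubs⊆neighbours u hub))
  where
  neighbours : Fin _ → Bool
  neighbours u = (T ─ v) u ∧ adj G v u
  hubs⊆neighbours : Extremal.hubs old ⊆ neighbours
  hubs⊆neighbours = Extremal-hubs⊆ old neighbours old-deg-v (λ w Nw → let T′w , vw = ∧≡true⇒ Nw in T′w , nbr-deg w T′w vw)
  not-neighbour : neighbours u ≡ true → ⊥
  not-neighbour Nu with () ← trans (sym (proj₂ (∧≡true⇒ Nu))) vu

Extremal-extend : ∀ {n} (G : Graph n) {k t T v} → T v ≡ true → degIn G T v ≡ k → Extremal G k (T ─ v) t →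
  (∀ u → (T ─ v) u ≡ true → adj G v u ≡ true → degIn G (T ─ v) u ≡ k + t) → Extremal G k T (suc t)
Extremal-extend G {k} {t} {T} {v} Tv deg-v old nbr-deg = record
  { hubs       = λ u → T u ∧ adj G v u
  ; count-hubs = deg-v
  ; deg-hub    = hub-degree
  ; deg-leaf   = leaf-degree
  }
  where
  hub-degree : ∀ u → T u ≡ true → T u ∧ adj G v u ≡ true → degIn G T u ≡ k + suc t
  hub-degree u Tu hub rewrite Tu = begin
    degIn G T u               ≡⟨ degIn-remove-adj G Tv hub ⟩
    suc (degIn G (T ─ v) u)   ≡⟨ cong suc (nbr-deg u (─-∈ T Tu (adj⇒≢ G hub)) hub) ⟩
    suc (k + t)               ≡⟨ +-suc k t ⟨
    k + suc t                 ∎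
    where open ≡-Reasoning

  leaf-degree : ∀ u → T u ≡ true → T u ∧ adj G v u ≡ false → degIn G T u ≡ k
  leaf-degree u Tu nonhub with v ≟ u | adj G v u in vu
  ... | yes refl | _     = deg-v
  ... | no v≢u   | false = trans (degIn-remove-nonadj G Tv vu)
                             (Extremal-nonneighbour G (trans (degIn-removed-self G T v) deg-v) old nbr-deg u (─-∈ T Tu v≢u) vu)
  ... | no v≢u   | true rewrite Tu with () ← nonhub


module _ {n} (G : Graph n) {k} (degenerate : Degenerate k G) where

  private
    lowVertex : ∀ {T : Fin n → Bool} {m} → countFin T ≡ suc m → ∃ λ v → T v ≡ true × degIn G T v ≤ k
    lowVertex {T} count = degenerate⇒lowDegree G degenerate (proj₂ (countFin-nonempty T count))

    count-─ : ∀ (T : Fin n → Bool) v {t} → T v ≡ true → countFin T ≡ suc (k + suc t) → countFin (T ─ v) ≡ suc (k + t)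
    count-─ T v {t} Tv count = trans (suc-injective (trans (sym (countFin-remove T v Tv)) count)) (+-suc k t)

    count-base : ∀ {T : Fin n → Bool} → countFin T ≡ suc (k + 0) → countFin T ≡ suc k
    count-base count = trans count (cong suc (+-identityʳ k))

  degenerate-energy-≤ : ∀ p t T → countFin T ≡ suc (k + t) → energy G p T ≤ extremalEnergy p k t
  degenerate-energy-≤ p zero    T count = energy-≤-base G p k (count-base count)
  degenerate-energy-≤ p (suc t) T count with v , Tv , v-low ← lowVertex count =
    Step.step-≤ G p k t {T} {v} Tv v-low (count-─ T v Tv count) (degenerate-energy-≤ p t (T ─ v) (count-─ T v Tv count))

  degenerate-extremal : ∀ p t T → 2 ≤ p → countFin T ≡ suc (k + t) → energy G p T ≡ extremalEnergy p k t →
    Extremal G k T t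
  degenerate-extremal p@(suc _) zero T _ count eq = Extremal-base G p k (count-base count) eq
  degenerate-extremal p (suc t) T 2≤p count eq with v , Tv , v-low ← lowVertex count
    with deg-v , eq′ , nbr-deg ← Step.step-≡ G p k t {T} {v} Tv v-low (count-─ T v Tv count)
                                   (degenerate-energy-≤ p t (T ─ v) (count-─ T v Tv count)) 2≤p eq =
    Extremal-extend G Tv deg-v (degenerate-extremal p t (T ─ v) 2≤p (count-─ T v Tv count) eq′) nbr-deg

-- The graphs S n k

countFin-others : ∀ {m} (i : Fin (suc m)) → countFin (λ j → not ⌊ i ≟ j ⌋) ≡ m
countFin-others i = suc-injective (trans (sym (countFin-remove (λ _ → true) i refl)) countFin-true)

permute-⌊≟⌋ : (σ : Permutation m n) (i j : Fin m) → ⌊ σ ⟨$⟩ʳ i ≟ σ ⟨$⟩ʳ j ⌋ ≡ ⌊ i ≟ j ⌋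
permute-⌊≟⌋ σ i j with i ≟ j | σ ⟨$⟩ʳ i ≟ σ ⟨$⟩ʳ j
... | yes _    | yes _  = refl
... | no _     | no _   = refl
... | yes refl | no σi≢σi = ⊥-elim (σi≢σi refl)
... | no i≢j   | yes σi≡σj = ⊥-elim (i≢j (trans (sym (inverseˡ σ)) (trans (cong (σ ⟨$⟩ˡ_) σi≡σj) (inverseˡ σ))))

≅⇒e≡ : ∀ {m n} {G : Graph m} {H : Graph n} p → G ≅ H → e p G ≡ e p H
≅⇒e≡ {G = G} {H} p (σ , adj-≡) =
  trans (sumFin-cong (λ i → cong (_^ p) (degree-≡ i))) (sumFin-permute (λ i → degree H i ^ p) σ)
  where
  degree-≡ : ∀ i → degree G i ≡ degree H (σ ⟨$⟩ʳ i)
  degree-≡ i = trans (countFin-cong (adj-≡ i)) (sumFin-permute (λ j → if adj H (σ ⟨$⟩ʳ i) j then 1 else 0) σ)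

adjacency⇒≅S : ∀ {n k} (G : Graph n) (A : Fin n → Bool) → countFin A ≡ k → k ≤ n →
  (∀ i j → adj G i j ≡ not ⌊ i ≟ j ⌋ ∧ (A i ∨ A j)) → G ≅ S n k
adjacency⇒≅S {k = k} G A count k≤n adjacency
  with σ , σ-A ← countFin-≡⇒permutation A (λ j → toℕ j <ᵇ k) (trans count (sym (countFin-<ᵇ k k≤n))) =
  σ , λ i j → trans (adjacency i j)
                     (sym (cong₂ (λ x y → not x ∧ y) (permute-⌊≟⌋ σ i j) (cong₂ _∨_ (σ-A i) (σ-A j))))

module _ {k t} (G : Graph (suc (k + t))) (E : Extremal G k (λ _ → true) t) where
  open Extremal E

  private
    hub-adj : ∀ i → hubs i ≡ true → ∀ j → adj G i j ≡ not ⌊ i ≟ j ⌋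
    hub-adj i hub = countFin-⊆-≡⇒≗ (λ j ij → ─-∈ (λ _ → true) refl (adj⇒≢ G ij))
                                     (trans (deg-hub i refl hub) (sym (countFin-others i)))

    leaf-adj : ∀ i → hubs i ≡ false → ∀ j → adj G i j ≡ hubs j
    leaf-adj i leaf j = sym (countFin-⊆-≡⇒≗ hubs⊆adj (trans count-hubs (sym (deg-leaf i refl leaf))) j)
      where
      hubs⊆adj : hubs ⊆ adj G i
      hubs⊆adj j hub = trans (Graph.sym G i j) (trans (hub-adj j hub i) (─-∈ (λ _ → true) refl j≢i))
        where
        j≢i : j ≢ i
        j≢i refl = not-¬ hub leaf

    adjacency : ∀ i j → adj G i j ≡ not ⌊ i ≟ j ⌋ ∧ (hubs i ∨ hubs j)
    adjacency i j with hubs i in hub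
    ... | true = trans (hub-adj i hub j) (sym (∧-identityʳ _))
    ... | false with i ≟ j
    ...   | no _     = leaf-adj i hub j
    ...   | yes refl = irrefl G i

  Extremal-complete⇒≅S : G ≅ S (suc (k + t)) k
  Extremal-complete⇒≅S = adjacency⇒≅S G hubs count-hubs (≤-trans (m≤m+n k t) (n≤1+n (k + t))) adjacency

  Extremal-complete-energy : ∀ p → e p G ≡ extremalEnergy p k t
  Extremal-complete-energy p = begin
    sumFin (λ i → degree G i ^ p)                                ≡⟨ sumFin-cong degree-by-role ⟩
    sumFin (λ i → if hubs i then (k + t) ^ p else k ^ p)         ≡⟨ sumFin-if hubs _ _ ⟩
    countFin hubs * (k + t) ^ p + countFin (not ∘ hubs) * k ^ p
      ≡⟨ cong₂ (λ a b → a * (k + t) ^ p + b * k ^ p) count-hubs count-leaves ⟩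
    extremalEnergy p k t                                         ∎
    where
    open ≡-Reasoning
    degree-by-role : ∀ i → degree G i ^ p ≡ (if hubs i then (k + t) ^ p else k ^ p)
    degree-by-role i with hubs i in hub
    ... | true  = cong (_^ p) (deg-hub i refl hub)
    ... | false = cong (_^ p) (deg-leaf i refl hub)
    count-leaves : countFin (not ∘ hubs) ≡ suc t
    count-leaves = +-cancelˡ-≡ k _ _ (begin
      k + countFin (not ∘ hubs)              ≡⟨ cong (_+ countFin (not ∘ hubs)) count-hubs ⟨
      countFin hubs + countFin (not ∘ hubs)  ≡⟨ countFin-complement hubs ⟩
      suc (k + t)                            ≡⟨ +-suc k t ⟨
      k + suc t                              ∎)

S-extremal : ∀ k t → Extremal (S (suc (k + t)) k) k (λ _ → true) t
S-extremal k t = record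
  { hubs       = small
  ; count-hubs = countFin-small
  ; deg-hub    = λ i _ hub → trans (countFin-cong (hub-row i hub)) (countFin-others i)
  ; deg-leaf   = λ i _ leaf → trans (countFin-cong (leaf-row i leaf)) countFin-small
  }
  where
  small : Fin (suc (k + t)) → Bool
  small j = toℕ j <ᵇ k
  countFin-small : countFin small ≡ k
  countFin-small = countFin-<ᵇ k (≤-trans (m≤m+n k t) (n≤1+n (k + t)))
  hub-row : ∀ i → small i ≡ true → ∀ j → adj (S (suc (k + t)) k) i j ≡ not ⌊ i ≟ j ⌋
  hub-row i hub j = trans (cong (λ b → not ⌊ i ≟ j ⌋ ∧ (b ∨ small j)) hub) (∧-identityʳ _)
  leaf-row : ∀ i → small i ≡ false → ∀ j → adj (S (suc (k + t)) k) i j ≡ small j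
  leaf-row i leaf j rewrite leaf with i ≟ j
  ... | yes refl = sym leaf
  ... | no _     = refl

m+1≤n⇒∃[o]1+m+o≡n : ∀ {m n} → m + 1 ≤ n → ∃ λ o → suc (m + o) ≡ n
m+1≤n⇒∃[o]1+m+o≡n {m} m+1≤n with o , m+1+o≡n ← m≤n⇒∃[o]m+o≡n m+1≤n =
  o , trans (sym (+-suc m o)) (trans (sym (+-assoc m 1 o)) m+1+o≡n)

extremalEnergy-≡ : ∀ p k t → k * (suc (k + t) ∸ 1) ^ p + (suc (k + t) ∸ k) * k ^ p ≡ extremalEnergy p k t
extremalEnergy-≡ p k t = cong (λ c → k * (k + t) ^ p + c * k ^ p) (trans (cong (_∸ k) (sym (+-suc k t))) (m+n∸m≡n k (suc t)))

theorem4 : (p k n : ℕ) → 1 < p → 1 ≤ k → k + 1 ≤ n → (G : Graph n) → Degenerate k G →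
    (e p G ≤ k * (n ∸ 1) ^ p + (n ∸ k) * k ^ p) ×
    ((e p G ≡ k * (n ∸ 1) ^ p + (n ∸ k) * k ^ p) ⇔ (G ≅ S n k))
theorem4 p k n 1<p _ k+1≤n G degenerate with t , refl ← m+1≤n⇒∃[o]1+m+o≡n k+1≤n rewrite extremalEnergy-≡ p k t =
  degenerate-energy-≤ G degenerate p t every countFin-true ,
  mk⇔ (λ extremal → Extremal-complete⇒≅S G (degenerate-extremal G degenerate p t every 1<p countFin-true extremal))
      (λ G≅S → trans (≅⇒e≡ {G = G} {H = S (suc (k + t)) k} p G≅S)
                     (Extremal-complete-energy (S (suc (k + t)) k) (S-extremal k t) p))
  where
  every : Fin (suc (k + t)) → Bool
  every _ = true
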